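{- Let $<$ be a relation on a type $A$ and $k,l:\mathsf{List}\,A$. If $k<^{\circ}l$, then $k<^{\circ}\mathsf{rot}^m(l)$ for every natural number $m$.
   Context: Homotopy type theory setting; relations are arbitrary type families. $\mathsf{rot}:\mathsf{List}\,A\to\mathsf{List}\,A$ removes the first element of a list (if it exists) and appends it at the end. The relation $<^L$ on $\mathsf{List}\,A$ is inductively generated by: if every element $y$ of $k$ satisfies $y<x$, then $(l_1::k::l_3)<^L(l_1::[x]::l_3)$. The relation $<^{\circ}$ on $\mathsf{List}\,A$ is $(k<^{\circ}l):=\Sigma(n:\mathbb N).\,\mathsf{rot}^n(k)<^Ll$. -}

module Defs where

open import Level using (Level; _⊔_)
open import Data.Nat using (ℕ; zero; suc)
open import Data.List using (List; []; _∷_; _++_; [_])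
open import Data.List.Relation.Unary.All using (All)
open import Data.Product using (Σ)
open import Function using (_∘_)

private variable
  a ℓ : Level

rot : {A : Set a} → List A → List A
rot []       = []
rot (x ∷ xs) = xs ++ [ x ]

rot^ : {A : Set a} → ℕ → List A → List A
rot^ zero    l = l
rot^ (suc n) l = rot (rot^ n l)

data _<ᴸ_ {A : Set a} {_<_ : A → A → Set ℓ} : List A → List A → Set (a ⊔ ℓ) where
  step : (l₁ k l₃ : List A) (x : A) → All (λ y → y < x) k →
         _<ᴸ_ {_<_ = _<_} (l₁ ++ k ++ l₃) (l₁ ++ [ x ] ++ l₃)

ListLt : {A : Set a} → (A → A → Set ℓ) → List A → List A → Set (a ⊔ ℓ)
ListLt _<_ = _<ᴸ_ {_<_ = _<_}

CycLt : {A : Set a} → (A → A → Set ℓ) → List A → List A → Set (a ⊔ ℓ)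
CycLt _<_ k l = Σ ℕ (λ n → ListLt _<_ (rot^ n k) l)

module Submission where

-- It suffices to treat a single rotation (m = 1) and then iterate.
-- A one-step comparison  k <ᴸ l  replaces one entry x of l by a block of
-- smaller entries.  Rotating l once either
--   * moves some entry in front of the replaced position to the back, and
--     rotating k once performs exactly the same move (the inner case), or
--   * moves the replaced entry x itself to the back; then rotating k by the
--     length of the replacing block moves that whole block to the back (the
--     boundary case).
-- Hence  k <ᴸ l  gives  rot^ j k <ᴸ rot l  for some j, and since rotations
-- compose additively, a cyclic comparison  k <° l  (witnessed by n) yields
-- k <° rot l  (witnessed by j + n).

open import Defs
open import Level using (Level)
open import Data.Nat using (ℕ; zero; suc; _+_)
open import Data.List using (List; []; _∷_; _++_; [_]; length)
open import Data.List.Properties using (++-assoc; ++-identityʳ)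
open import Data.List.Relation.Unary.All using (All)
open import Data.Product using (Σ; _,_)
open import Relation.Binary.PropositionalEquality
  using (_≡_; refl; sym; cong; subst; subst₂; module ≡-Reasoning)

private variable
  a ℓ : Level
  A : Set a

rot^-suc : (n : ℕ) (l : List A) → rot^ (suc n) l ≡ rot^ n (rot l)
rot^-suc zero    l = refl
rot^-suc (suc n) l = cong rot (rot^-suc n l)

rot^-+ : (j n : ℕ) (l : List A) → rot^ j (rot^ n l) ≡ rot^ (j + n) l
rot^-+ zero    n l = refl
rot^-+ (suc j) n l = cong rot (rot^-+ j n l)

rot^-length-++ : (p r : List A) → rot^ (length p) (p ++ r) ≡ r ++ p
rot^-length-++ []      r = sym (++-identityʳ r)
rot^-length-++ (y ∷ p) r = begin
  rot^ (suc (length p)) (y ∷ p ++ r)  ≡⟨ rot^-suc (length p) (y ∷ p ++ r) ⟩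
  rot^ (length p) ((p ++ r) ++ [ y ]) ≡⟨ cong (rot^ (length p)) (++-assoc p r [ y ]) ⟩
  rot^ (length p) (p ++ r ++ [ y ])   ≡⟨ rot^-length-++ p (r ++ [ y ]) ⟩
  (r ++ [ y ]) ++ p                   ≡⟨ ++-assoc r [ y ] p ⟩
  r ++ y ∷ p                          ∎
  where open ≡-Reasoning

<ᴸ-rot-front : (_<_ : A → A → Set ℓ) (k l₃ : List A) (x : A) →
               All (λ y → y < x) k →
               ListLt _<_ (rot^ (length k) (k ++ l₃)) (rot (x ∷ l₃))
<ᴸ-rot-front _<_ k l₃ x k<x =
  subst (λ z → ListLt _<_ z (l₃ ++ [ x ])) lhs≡ (step l₃ k [] x k<x)
  where
  open ≡-Reasoning
  lhs≡ : l₃ ++ k ++ [] ≡ rot^ (length k) (k ++ l₃)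
  lhs≡ = begin
    l₃ ++ k ++ []                ≡⟨ cong (l₃ ++_) (++-identityʳ k) ⟩
    l₃ ++ k                      ≡⟨ sym (rot^-length-++ k l₃) ⟩
    rot^ (length k) (k ++ l₃)    ∎

<ᴸ-rot-inner : (_<_ : A → A → Set ℓ) (y : A) (l₁ k l₃ : List A) (x : A) →
               All (λ z → z < x) k →
               ListLt _<_ (rot (y ∷ l₁ ++ k ++ l₃)) (rot (y ∷ l₁ ++ x ∷ l₃))
<ᴸ-rot-inner _<_ y l₁ k l₃ x k<x =
  subst₂ (ListLt _<_) lhs≡ (sym (++-assoc l₁ (x ∷ l₃) [ y ]))
    (step l₁ k (l₃ ++ [ y ]) x k<x)
  where
  open ≡-Reasoning
  lhs≡ : l₁ ++ k ++ l₃ ++ [ y ] ≡ (l₁ ++ k ++ l₃) ++ [ y ]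
  lhs≡ = begin
    l₁ ++ k ++ l₃ ++ [ y ]       ≡⟨ cong (l₁ ++_) (sym (++-assoc k l₃ [ y ])) ⟩
    l₁ ++ (k ++ l₃) ++ [ y ]     ≡⟨ sym (++-assoc l₁ (k ++ l₃) [ y ]) ⟩
    (l₁ ++ k ++ l₃) ++ [ y ]     ∎

<ᴸ-rot : (_<_ : A → A → Set ℓ) (k l : List A) →
         ListLt _<_ k l → Σ ℕ (λ j → ListLt _<_ (rot^ j k) (rot l))
<ᴸ-rot _<_ _ _ (step []       k l₃ x k<x) = length k , <ᴸ-rot-front _<_ k l₃ x k<x
<ᴸ-rot _<_ _ _ (step (y ∷ l₁) k l₃ x k<x) = 1 , <ᴸ-rot-inner _<_ y l₁ k l₃ x k<x

<°-rot : (_<_ : A → A → Set ℓ) (k l : List A) →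
         CycLt _<_ k l → CycLt _<_ k (rot l)
<°-rot _<_ k l (n , rotⁿk<l) with <ᴸ-rot _<_ (rot^ n k) l rotⁿk<l
... | j , rotʲrotⁿk<rotl =
  j + n , subst (λ z → ListLt _<_ z (rot l)) (rot^-+ j n k) rotʲrotⁿk<rotl

lemma5p7 : {a ℓ : Level} {A : Set a} (_<_ : A → A → Set ℓ) (k l : List A) →
           CycLt _<_ k l → (m : ℕ) → CycLt _<_ k (rot^ m l)
lemma5p7 _<_ k l k<l zero    = k<l
lemma5p7 _<_ k l k<l (suc m) = <°-rot _<_ k (rot^ m l) (lemma5p7 _<_ k l k<l m)
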